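{- Let $\mathcal B$ be a paraconsistent BALFI for $\mathbf{RCbr}$, and suppose there exists $x\in\mathcal I$ such that $x\sqcap\tilde\neg x\in\mathcal I$. Then $\tilde\circ x\not\leq\tilde\circ\tilde\circ x$, and consequently $\mathcal B$ does not validate the schema $\circ\alpha\rightarrow\circ\circ\alpha$.
   Context: A BALFI for $\mathbf{RCbr}$ is a Boolean algebra $\mathcal B$ (with meet $\sqcap$, join $\sqcup$, complement $-$, implication $a\Rightarrow b=-a\sqcup b$, order $\leq$, least element $0$ and greatest element $1$) expanded with two unary operators $\tilde\neg$ and $\tilde\circ$ such that, for every $x$: $x\sqcup\tilde\neg x=1$, $x\sqcap\tilde\neg x\sqcap\tilde\circ x=0$, $\tilde\circ x=-(x\sqcap\tilde\neg x)$, and $\tilde\neg\tilde\neg x=x$. Let $\mathcal C=\{x\in\mathcal B: x\sqcap\tilde\neg x=0\}$ and $\mathcal I=\mathcal B\setminus\mathcal C$ (the inconsistent elements); $\mathcal B$ is paraconsistent if $\mathcal I\neq\emptyset$. Formulas are built from propositional variables with binary $\wedge,\vee,\rightarrow$ and unary $\neg,\circ$. A valuation over $\mathcal B$ is a homomorphism $h$ from the formula algebra to $\mathcal B$, i.e. $h(\alpha\wedge\beta)=h(\alpha)\sqcap h(\beta)$, $h(\alpha\vee\beta)=h(\alpha)\sqcup h(\beta)$, $h(\alpha\rightarrow\beta)=h(\alpha)\Rightarrow h(\beta)$, $h(\neg\alpha)=\tilde\neg h(\alpha)$, $h(\circ\alpha)=\tilde\circ h(\alpha)$. $\mathcal B$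 validates a schema if every instance $\varphi$ satisfies $h(\varphi)=1$ for every valuation $h$ over $\mathcal B$. -}

module Defs where

open import Level using (Level; _⊔_) renaming (suc to lsuc)
open import Data.Nat using (ℕ)
open import Data.Product using (Σ; _×_; ∃)
open import Relation.Nullary using () renaming (¬_ to ¬'_)
open import Algebra.Lattice.Bundles using (BooleanAlgebra)

-- A BALFI for RCbr over a Boolean algebra B (whose equality is the setoid
-- equality _≈_ of B).  ~¬ and ~∘ are the extra unary operators; they are
-- required to respect _≈_ (automatic for genuine functions on the carrier
-- when _≈_ is propositional equality).
record BALFI-RCbr {c ℓ : Level} (B : BooleanAlgebra c ℓ) : Set (c ⊔ ℓ) where
  open BooleanAlgebra B
  field
    ~¬ : Carrier → Carrier
    ~∘ : Carrier → Carrier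
    ~¬-cong : ∀ {x y} → x ≈ y → ~¬ x ≈ ~¬ y
    ~∘-cong : ∀ {x y} → x ≈ y → ~∘ x ≈ ~∘ y
    ax-neg : ∀ x → (x ∨ ~¬ x) ≈ ⊤
    ax-ci  : ∀ x → ((x ∧ ~¬ x) ∧ ~∘ x) ≈ ⊥
    ax-circ : ∀ x → ~∘ x ≈ ¬ (x ∧ ~¬ x)
    ax-cf  : ∀ x → ~¬ (~¬ x) ≈ x

module BALFINotions {c ℓ : Level} {B : BooleanAlgebra c ℓ} (M : BALFI-RCbr B) where
  open BooleanAlgebra B
  open BALFI-RCbr M

  _≤B_ : Carrier → Carrier → Set ℓ
  a ≤B b = (a ∧ b) ≈ a

  _⇒_ : Carrier → Carrier → Carrier
  a ⇒ b = ¬ a ∨ b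

  InC : Carrier → Set ℓ
  InC x = (x ∧ ~¬ x) ≈ ⊥

  InI : Carrier → Set ℓ
  InI x = ¬' (InC x)

  Paraconsistent : Set (c ⊔ ℓ)
  Paraconsistent = ∃ λ x → InI x

data Formula : Set where
  var  : ℕ → Formula
  _∧f_ : Formula → Formula → Formula
  _∨f_ : Formula → Formula → Formula
  _→f_ : Formula → Formula → Formula
  ¬f_  : Formula → Formula
  ∘f_  : Formula → Formula

module Semantics {c ℓ : Level} {B : BooleanAlgebra c ℓ} (M : BALFI-RCbr B) where
  open BooleanAlgebra B
  open BALFI-RCbr M
  open BALFINotions M

  ⟦_⟧ : Formula → (ℕ → Carrier) → Carrier
  ⟦ var n ⟧ v = v n
  ⟦ φ ∧f ψ ⟧ v = ⟦ φ ⟧ v ∧ ⟦ ψ ⟧ v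
  ⟦ φ ∨f ψ ⟧ v = ⟦ φ ⟧ v ∨ ⟦ ψ ⟧ v
  ⟦ φ →f ψ ⟧ v = ⟦ φ ⟧ v ⇒ ⟦ ψ ⟧ v
  ⟦ ¬f φ ⟧ v = ~¬ (⟦ φ ⟧ v)
  ⟦ ∘f φ ⟧ v = ~∘ (⟦ φ ⟧ v)

  ValidatesCiw2 : Set (c ⊔ ℓ)
  ValidatesCiw2 = ∀ (α : Formula) (v : ℕ → Carrier) → ⟦ (∘f α) →f (∘f (∘f α)) ⟧ v ≈ ⊤

{-# OPTIONS --safe #-}
-- If ∘x ≤ ∘∘x, then a := ∘x satisfies a ⊓ ¬̃a = 0, and with a ⊔ ¬̃a = 1 this
-- forces ¬̃a = −a.  In RCbr the law ¬̃¬̃a = a then gives ¬̃(−a) = a, so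
-- −a = x ⊓ ¬̃x is consistent, against the hypothesis.  An instance of
-- ∘α → ∘∘α evaluating to 1 is exactly the inequality ∘x ≤ ∘∘x.
module Submission where

open import Defs
open import Level using (Level)
open import Data.Product using (_×_; _,_)
open import Function using (const)
open import Relation.Nullary using (¬_)
open import Algebra.Lattice.Bundles using (BooleanAlgebra)
import Algebra.Lattice.Properties.BooleanAlgebra as BooleanAlgebraProperties
import Relation.Binary.Reasoning.Setoid as SetoidReasoning

module BooleanLemmas {c ℓ : Level} (B : BooleanAlgebra c ℓ) where
  open BooleanAlgebra B renaming (¬_ to -_)
  open BooleanAlgebraProperties B using (∧-identityʳ; ∧-identityˡ; ∨-identityˡ)
  open SetoidReasoning setoid

  complement-unique : ∀ x y → x ∧ y ≈ ⊥ → x ∨ y ≈ ⊤ → - x ≈ y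
  complement-unique x y x∧y≈⊥ x∨y≈⊤ = begin
    - x                ≈⟨ ∧-identityʳ _ ⟨
    - x ∧ ⊤            ≈⟨ ∧-congˡ x∨y≈⊤ ⟨
    - x ∧ (x ∨ y)      ≈⟨ ∧-distribˡ-∨ _ _ _ ⟩
    - x ∧ x ∨ - x ∧ y  ≈⟨ ∨-congʳ (trans (∧-complementˡ _) (sym x∧y≈⊥)) ⟩
    x ∧ y ∨ - x ∧ y    ≈⟨ ∧-distribʳ-∨ _ _ _ ⟨
    (x ∨ - x) ∧ y      ≈⟨ ∧-congʳ (∨-complementʳ _) ⟩
    ⊤ ∧ y              ≈⟨ ∧-identityˡ _ ⟩
    y                  ∎

  x∧-[x∧y]≈x⇒x∧y≈⊥ : ∀ x y → x ∧ - (x ∧ y) ≈ x → x ∧ y ≈ ⊥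
  x∧-[x∧y]≈x⇒x∧y≈⊥ x y x≤-[x∧y] = begin
    x ∧ y                ≈⟨ ∧-congʳ x≤-[x∧y] ⟨
    (x ∧ - (x ∧ y)) ∧ y  ≈⟨ ∧-congʳ (∧-comm _ _) ⟩
    (- (x ∧ y) ∧ x) ∧ y  ≈⟨ ∧-assoc _ _ _ ⟩
    - (x ∧ y) ∧ (x ∧ y)  ≈⟨ ∧-complementˡ _ ⟩
    ⊥                    ∎

  -x∨y≈⊤⇒x∧y≈x : ∀ x y → - x ∨ y ≈ ⊤ → x ∧ y ≈ x
  -x∨y≈⊤⇒x∧y≈x x y -x∨y≈⊤ = begin
    x ∧ y              ≈⟨ ∨-identityˡ _ ⟨
    ⊥ ∨ x ∧ y          ≈⟨ ∨-congʳ (∧-complementʳ x) ⟨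
    x ∧ - x ∨ x ∧ y    ≈⟨ ∧-distribˡ-∨ _ _ _ ⟨
    x ∧ (- x ∨ y)      ≈⟨ ∧-congˡ -x∨y≈⊤ ⟩
    x ∧ ⊤              ≈⟨ ∧-identityʳ _ ⟩
    x                  ∎

module RCbrLemmas {c ℓ : Level} {B : BooleanAlgebra c ℓ} (M : BALFI-RCbr B) where
  open BooleanAlgebra B renaming (¬_ to -_)
  open BooleanAlgebraProperties B using (¬-involutive)
  open BALFI-RCbr M
  open BALFINotions M
  open Semantics M
  open BooleanLemmas B

  InC-cong : ∀ {x y} → x ≈ y → InC x → InC y
  InC-cong x≈y x∧~¬x≈⊥ = trans (sym (∧-cong x≈y (~¬-cong x≈y))) x∧~¬x≈⊥

  InC⇒~¬≈- : ∀ {x} → InC x → ~¬ x ≈ - x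
  InC⇒~¬≈- {x} x∧~¬x≈⊥ = sym (complement-unique x (~¬ x) x∧~¬x≈⊥ (ax-neg x))

  InC-complement : ∀ {x} → InC x → InC (- x)
  InC-complement {x} x∧~¬x≈⊥ = begin
    - x ∧ ~¬ (- x)   ≈⟨ ∧-congˡ (~¬-cong (InC⇒~¬≈- x∧~¬x≈⊥)) ⟨
    - x ∧ ~¬ (~¬ x)  ≈⟨ ∧-congˡ (ax-cf x) ⟩
    - x ∧ x          ≈⟨ ∧-complementˡ x ⟩
    ⊥                ∎
    where open SetoidReasoning setoid

  ≤~∘⇒InC : ∀ {x} → x ≤B ~∘ x → InC x
  ≤~∘⇒InC {x} x≤~∘x = x∧-[x∧y]≈x⇒x∧y≈⊥ x (~¬ x) (trans (∧-congˡ (sym (ax-circ x))) x≤~∘x)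

  InC-~∘⇒InC-∧~¬ : ∀ {x} → InC (~∘ x) → InC (x ∧ ~¬ x)
  InC-~∘⇒InC-∧~¬ {x} consistent =
    InC-cong (¬-involutive _) (InC-complement (InC-cong (ax-circ x) consistent))

  ~∘≰~∘~∘ : ∀ {x} → InI (x ∧ ~¬ x) → ¬ (~∘ x ≤B ~∘ (~∘ x))
  ~∘≰~∘~∘ inconsistent ~∘x≤~∘~∘x = inconsistent (InC-~∘⇒InC-∧~¬ (≤~∘⇒InC ~∘x≤~∘~∘x))

  ValidatesCiw2⇒~∘≤~∘~∘ : ValidatesCiw2 → ∀ x → ~∘ x ≤B ~∘ (~∘ x)
  ValidatesCiw2⇒~∘≤~∘~∘ valid x = -x∨y≈⊤⇒x∧y≈x _ _ (valid (var 0) (const x))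

proposition4p3 : ∀ {c ℓ : Level} (B : BooleanAlgebra c ℓ) (M : BALFI-RCbr B)
    → BALFINotions.Paraconsistent M
    → (x : BooleanAlgebra.Carrier B)
    → BALFINotions.InI M x
    → BALFINotions.InI M (BooleanAlgebra._∧_ B x (BALFI-RCbr.~¬ M x))
    → ¬ BALFINotions._≤B_ M (BALFI-RCbr.~∘ M x) (BALFI-RCbr.~∘ M (BALFI-RCbr.~∘ M x))
      × ¬ Semantics.ValidatesCiw2 M
proposition4p3 B M _ x _ inconsistent =
  ~∘≰~∘~∘ inconsistent , λ valid → ~∘≰~∘~∘ inconsistent (ValidatesCiw2⇒~∘≤~∘~∘ valid x)
  where open RCbrLemmas M
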